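{- Let $\phi$ be a scheduling type, $f\in\mathcal B(\phi)$ a scheduling bound for $\phi$, and $\sigma$ an activation with $\sigma\models f:\phi$. Then every sub-activation $\sigma'\subseteq\sigma$ satisfies $\sigma'\models f:\phi$. Moreover, if $|\sigma|=0$ (i.e. $\sigma$ is the empty activation), then $\sigma\models f:\phi$ for every type $\phi$ and every $f\in\mathcal B(\phi)$.
   Context: Fix a set $\mathbb V$ of control variables. Let $\mathbb N_\infty=\mathbb N\cup\{ -\infty,+\infty\}$ with the usual order. For $n\in\mathbb N$ let $\underline n=\{0,1,\dots,n-1\}$. An activation is a function $\sigma:\underline n\to 2^{\mathbb V}$ (some $n\in\mathbb N$) with $\sigma(i)\subseteq\sigma(j)$ whenever $i\le j$; its length is $|\sigma|=n$, and the activation with $n=0$ is the empty activation. A sub-activation $\sigma'\subseteq\sigma$ of $\sigma:\underline n\to2^{\mathbb V}$ is an activation $\sigma':\underline m\to 2^{\mathbb V}$ such that there is a strictly increasing $g:\underline m\to\underline n$ (index embedding) with $\sigma'(i)=\sigma(g(i))$ for all $i<m$. We write $\sigma=\sigma_1\cup\sigma_2$ if $\sigma_1,\sigma_2\subseteq\sigma$ with index embeddings $g_1,g_2$ such that every $i<n$ lies in the image of $g_1$ or of $g_2$. For $i\in\mathbb N$ the shifted activation $\sigma[i,:]$ has length $\max(n-i,0)$ and $\sigma[i,:](j)=\sigma(j+i)$. Scheduling types are generated by $\phi::= A\mid \mathit{true}\mid\mathit{false}\mid\phi\wedge\phi\mid\neg\phi\mid\phi\supset\phi\mid\phi\vee\phi\mid\phi\oplus\phi\mid\phi\otimes\phi\mid\circ\phi$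 with $A\in\mathbb V$. The set of scheduling bounds $\mathcal B(\phi)$ is defined by: $\mathcal B(\mathit{false})=\mathcal B(\mathit{true})=\mathcal B(A)=\mathcal B(\neg\phi)=\underline 1=\{0\}$; $\mathcal B(\phi\wedge\psi)=\mathcal B(\phi\oplus\psi)=\mathcal B(\phi\otimes\psi)=\mathcal B(\phi)\times\mathcal B(\psi)$; $\mathcal B(\phi\vee\psi)=\{(0,f):f\in\mathcal B(\phi)\}\cup\{(1,g):g\in\mathcal B(\psi)\}$; $\mathcal B(\phi\supset\psi)$ is the set of all functions $\mathcal B(\phi)\to\mathcal B(\psi)$; $\mathcal B(\circ\phi)=\mathbb N_\infty\times\mathcal B(\phi)$. Satisfaction $\sigma\models f:\phi$ (for $f\in\mathcal B(\phi)$) is defined inductively: $\sigma\models 0:\mathit{false}$ iff $|\sigma|=0$; $\sigma\models 0:\mathit{true}$ always; $\sigma\models 0:A$ iff $A\in\sigma(i)$ for all $i<|\sigma|$; $\sigma\models(f,g):\phi\wedge\psi$ iff $\sigma\models f:\phi$ and $\sigma\models g:\psi$; $\sigma\models(0,f):\phi\vee\psi$ iff $\sigma\models f:\phi$, and $\sigma\models(1,g):\phi\vee\psi$ iff $\sigma\models g:\psi$; $\sigma\models(f,g):\phi\oplus\psi$ iff $\sigma\models f:\phi$ or $\sigma\models g:\psi$; $\sigma\models f:\phi\supset\psi$ iff for every sub-activation $\sigma'\subseteq\sigma$ and every $g\in\mathcal B(\phi)$, $\sigma'\models g:\phi$ implies $\sigma'\models f(g):\psi$; $\sigma\models(d,f):\circ\phi$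 iff $|\sigma|=0$ or there is $i\in\mathbb N$ with $0\le i\le d$ and $\sigma[i,:]\models f:\phi$; $\sigma\models(f,g):\phi\otimes\psi$ iff there are $\sigma_1,\sigma_2\subseteq\sigma$ with $\sigma=\sigma_1\cup\sigma_2$, $\sigma_1\models f:\phi$ and $\sigma_2\models g:\psi$; and $\neg\phi$ is interpreted as $\phi\supset\mathit{false}$, i.e. $\sigma\models 0:\neg\phi$ iff $\sigma\models h:\phi\supset\mathit{false}$ where $h$ is the constant function with value $0$. -}

module Defs where

open import Level using (0ℓ)
import Level
import Data.Nat.Properties
import Data.Fin.Properties
open import Data.Nat using (ℕ; zero; suc; _+_; _∸_; z≤n; s≤s) renaming (_≤_ to _≤ℕ_; _<_ to _<ℕ_)
open import Data.Nat.Properties using (+-suc; +-monoˡ-≤)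
open import Data.Fin using (Fin; toℕ; fromℕ<) renaming (_≤_ to _≤F_; _<_ to _<F_)
open import Data.Fin.Properties using (toℕ-fromℕ<)
open import Data.Product using (Σ; _×_; _,_; ∃-syntax)
open import Data.Sum using (_⊎_)
open import Data.Unit using (⊤; tt)
open import Data.Empty using (⊥)
open import Relation.Unary using (Pred; _⊆_; _≐_; _∈_)
open import Relation.Binary.PropositionalEquality using (_≡_; refl; subst; sym)

data ℕ∞ : Set where
  -∞ +∞ : ℕ∞
  fin  : ℕ → ℕ∞

_≤∞_ : ℕ → ℕ∞ → Set
i ≤∞ -∞    = ⊥
i ≤∞ +∞    = ⊤
i ≤∞ fin k = i ≤ℕ k

module _ (V : Set) where

  Subset : Set₁
  Subset = Pred V 0ℓ

  record Activation : Set₁ where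
    constructor act
    field
      len  : ℕ
      at   : Fin len → Subset
      mono : ∀ {i j} → i ≤F j → at i ⊆ at j
  open Activation public

  -- σ' ⊆ σ : sub-activation, witnessed by a strictly increasing index embedding g
  -- with σ'(i) = σ(g i) (equality of subsets = extensional equality)
  record Embedding (σ' σ : Activation) : Set₁ where
    field
      g      : Fin (len σ') → Fin (len σ)
      strict : ∀ {i j} → i <F j → g i <F g j
      agree  : ∀ i → at σ' i ≐ at σ (g i)
  open Embedding public

  _⊑_ : Activation → Activation → Set₁
  σ' ⊑ σ = Embedding σ' σ

  Covers : {σ₁ σ₂ σ : Activation} → Embedding σ₁ σ → Embedding σ₂ σ → Set
  Covers {σ₁} {σ₂} {σ} e₁ e₂ =
    ∀ (i : Fin (len σ)) → (∃[ j ] g e₁ j ≡ i) ⊎ (∃[ j ] g e₂ j ≡ i)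

  private
    lem : ∀ j i n → j <ℕ n ∸ i → j + i <ℕ n
    lem j zero n p rewrite Data.Nat.Properties.+-identityʳ j = p
    lem j (suc i) zero ()
    lem j (suc i) (suc n) p rewrite +-suc j i = s≤s (lem j i n p)

    shiftIx : ∀ {n} i → Fin (n ∸ i) → Fin n
    shiftIx {n} i j = fromℕ< (lem (toℕ j) i n (Data.Fin.Properties.toℕ<n j))

    shiftMono : ∀ {n} i {j k : Fin (n ∸ i)} → j ≤F k → shiftIx {n} i j ≤F shiftIx {n} i k
    shiftMono {n} i {j} {k} p
      rewrite toℕ-fromℕ< (lem (toℕ j) i n (Data.Fin.Properties.toℕ<n j))
            | toℕ-fromℕ< (lem (toℕ k) i n (Data.Fin.Properties.toℕ<n k))
      = +-monoˡ-≤ i p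

  -- shifted activation σ[i,:], of length max(n - i, 0) = n ∸ i
  shift : Activation → ℕ → Activation
  shift σ i = act (len σ ∸ i) (λ j → at σ (shiftIx i j))
                  (λ p → mono σ (shiftMono i p))

  data Ty : Set where
    `A     : V → Ty
    `true  : Ty
    `false : Ty
    _∧_    : Ty → Ty → Ty
    ¬'_    : Ty → Ty
    _⊃_    : Ty → Ty → Ty
    _∨_    : Ty → Ty → Ty
    _⊕_    : Ty → Ty → Ty
    _⊗_    : Ty → Ty → Ty
    ○_     : Ty → Ty

  B : Ty → Set
  B (`A _)  = Fin 1
  B `true   = Fin 1
  B `false  = Fin 1
  B (¬' φ)  = Fin 1
  B (φ ∧ ψ) = B φ × B ψ
  B (φ ⊕ ψ) = B φ × B ψ
  B (φ ⊗ ψ) = B φ × B ψ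
  B (φ ∨ ψ) = Σ (Fin 2) λ { Fin.zero → B φ ; (Fin.suc _) → B ψ }
  B (φ ⊃ ψ) = B φ → B ψ
  B (○ φ)   = ℕ∞ × B φ

  Sat : Activation → (φ : Ty) → B φ → Set₁
  Sat σ (`A a)  _ = Level.Lift (Level.suc 0ℓ) (∀ (i : Fin (len σ)) → a ∈ at σ i)
  Sat σ `true   _ = Level.Lift (Level.suc 0ℓ) ⊤
  Sat σ `false  _ = Level.Lift (Level.suc 0ℓ) (len σ ≡ 0)
  Sat σ (φ ∧ ψ) (f , g') = Sat σ φ f × Sat σ ψ g'
  Sat σ (φ ∨ ψ) (Fin.zero , f)  = Sat σ φ f
  Sat σ (φ ∨ ψ) (Fin.suc _ , g') = Sat σ ψ g'
  Sat σ (φ ⊕ ψ) (f , g') = Sat σ φ f ⊎ Sat σ ψ g'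
  Sat σ (φ ⊃ ψ) f = ∀ (σ' : Activation) → σ' ⊑ σ →
                    ∀ (h : B φ) → Sat σ' φ h → Sat σ' ψ (f h)
  Sat σ (¬' φ)  _ = ∀ (σ' : Activation) → σ' ⊑ σ →
                    ∀ (h : B φ) → Sat σ' φ h → Level.Lift (Level.suc 0ℓ) (len σ' ≡ 0)
  Sat σ (○ φ) (d , f) = Level.Lift (Level.suc 0ℓ) (len σ ≡ 0) ⊎
                        (Σ ℕ λ i → Level.Lift (Level.suc 0ℓ) (i ≤∞ d) × Sat (shift σ i) φ f)
  Sat σ (φ ⊗ ψ) (f , g') = Σ Activation λ σ₁ → Σ Activation λ σ₂ →
                           Σ (σ₁ ⊑ σ) λ e₁ → Σ (σ₂ ⊑ σ) λ e₂ →
                           Level.Lift (Level.suc 0ℓ) (Covers e₁ e₂) × Sat σ₁ φ f × Sat σ₂ ψ g'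

-- For ⊃ and ¬ closure under sub-activations
-- is just transitivity of ⊑. For ○ φ the offset i that works for σ also works for
-- σ': an index embedding never moves an index backwards, so it restricts to an
-- embedding σ'[i,:] ⊆ σ[i,:]. For φ ⊗ ψ the cover σ = σ₁ ∪ σ₂ is pulled back along
-- σ' ⊆ σ by splitting the indices of σ' according to the side of the cover their
-- image falls on. On the empty activation every clause holds, ⊗ via σ = σ ∪ σ.
module Submission where

open import Defs
open import Data.Nat using (ℕ; _+_; _∸_; z≤n; s≤s)
open import Data.Product using (_×_; Σ; _,_; proj₁; proj₂; ∃-syntax)
open import Relation.Binary.PropositionalEquality
  using (_≡_; refl; sym; cong; subst; subst₂; module ≡-Reasoning)

open import Level using (lift)
open import Function using (id; _∘_)
open import Data.Bool using (Bool; true; false; T)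
open import Data.Empty using (⊥-elim)
open import Data.Unit using (tt)
open import Data.Maybe using (is-just; to-witness-T)
open import Data.Sum using (_⊎_; inj₁; inj₂; isInj₁; isInj₂)
import Data.Nat as ℕ using (zero; suc; _≤_; _<_)
import Data.Nat.Properties as ℕ
open import Data.Fin using (Fin; zero; suc; toℕ; fromℕ<; inject₁; _<_; _≤_)
open import Data.Fin.Properties
  using (¬Fin0; toℕ<n; toℕ-fromℕ<; toℕ-injective; toℕ-inject₁; ≤̄⇒inject₁<; <-cmp)
open import Relation.Binary.Core using (_Preserves_⟶_)
open import Relation.Binary.Definitions using (tri<; tri≈; tri>)
open import Relation.Unary using (_≐_)
open import Relation.Unary.Properties using (≐-refl; ≐-sym; ≐-trans)

strict⇒monotone : ∀ {m n} {h : Fin m → Fin n} →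
                  h Preserves _<_ ⟶ _<_ → h Preserves _≤_ ⟶ _≤_
strict⇒monotone h-strict {i} {j} i≤j with <-cmp i j
... | tri< i<j _ _ = ℕ.<⇒≤ (h-strict i<j)
... | tri≈ _ refl _ = ℕ.≤-refl
... | tri> _ _ j<i = ⊥-elim (ℕ.<⇒≱ j<i i≤j)

strict-reflects : ∀ {m n} {h : Fin m → Fin n} → h Preserves _<_ ⟶ _<_ →
                  ∀ {i j} → h i < h j → i < j
strict-reflects h-strict {i} {j} hi<hj with <-cmp i j
... | tri< i<j _ _ = i<j
... | tri≈ _ refl _ = ⊥-elim (ℕ.<-irrefl refl hi<hj)
... | tri> _ _ j<i = ⊥-elim (ℕ.<-asym hi<hj (h-strict j<i))

strict-inflationary : ∀ {m n} (h : Fin m → Fin n) → h Preserves _<_ ⟶ _<_ →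
                      ∀ j → toℕ j ℕ.≤ toℕ (h j)
strict-inflationary h h-strict zero    = z≤n
strict-inflationary h h-strict (suc j) =
  ℕ.≤-<-trans (strict-inflationary (h ∘ inject₁) (h-strict ∘ inject₁-strict) j)
              (h-strict (≤̄⇒inject₁< ℕ.≤-refl))
  where
  inject₁-strict : ∀ {a b} → a < b → inject₁ a < inject₁ b
  inject₁-strict {a} {b} = subst₂ ℕ._<_ (sym (toℕ-inject₁ a)) (sym (toℕ-inject₁ b))

count : ∀ {n} → (Fin n → Bool) → ℕ
count {ℕ.zero}  b = 0
count {ℕ.suc n} b with b zero
... | true  = ℕ.suc (count (b ∘ suc))
... | false = count (b ∘ suc)

select : ∀ {n} (b : Fin n → Bool) → Fin (count b) → Fin n
select {ℕ.suc n} b k with b zero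
select {ℕ.suc n} b zero    | true  = zero
select {ℕ.suc n} b (suc k) | true  = suc (select (b ∘ suc) k)
... | false = suc (select (b ∘ suc) k)

select-strict : ∀ {n} (b : Fin n → Bool) → select b Preserves _<_ ⟶ _<_
select-strict {ℕ.suc n} b {i} {j} i<j with b zero
select-strict {ℕ.suc n} b {zero}  {suc j} i<j       | true = s≤s z≤n
select-strict {ℕ.suc n} b {suc i} {suc j} (s≤s i<j) | true = s≤s (select-strict (b ∘ suc) i<j)
... | false = s≤s (select-strict (b ∘ suc) i<j)

select-sound : ∀ {n} (b : Fin n → Bool) k → T (b (select b k))
select-sound {ℕ.suc n} b k with b zero in eq
select-sound {ℕ.suc n} b zero    | true rewrite eq = tt
select-sound {ℕ.suc n} b (suc k) | true  = select-sound (b ∘ suc) k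
... | false = select-sound (b ∘ suc) k

select-complete : ∀ {n} (b : Fin n → Bool) j → T (b j) → ∃[ k ] select b k ≡ j
select-complete {ℕ.suc n} b j bj with b zero in eq
select-complete {ℕ.suc n} b zero    bj | true = zero , refl
select-complete {ℕ.suc n} b (suc j) bj | true with select-complete (b ∘ suc) j bj
... | k , refl = suc k , refl
select-complete {ℕ.suc n} b zero    bj | false rewrite eq = ⊥-elim bj
select-complete {ℕ.suc n} b (suc j) bj | false with select-complete (b ∘ suc) j bj
... | k , refl = k , refl

m<o∸n⇒m+n<o : ∀ m n o → m ℕ.< o ∸ n → m + n ℕ.< o
m<o∸n⇒m+n<o m ℕ.zero    o       m<o rewrite ℕ.+-identityʳ m = m<o
m<o∸n⇒m+n<o m (ℕ.suc n) (ℕ.suc o) m<o rewrite ℕ.+-suc m n = s≤s (m<o∸n⇒m+n<o m n o m<o)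

-- The same index map as the one hidden in the definition of shift (fromℕ< ignores its
-- proof argument), so that shift-⊑ below holds with ≐-refl.
shift-index : ∀ {n} i → Fin (n ∸ i) → Fin n
shift-index {n} i j = fromℕ< (m<o∸n⇒m+n<o (toℕ j) i n (toℕ<n j))

toℕ-shift-index : ∀ {n} i (j : Fin (n ∸ i)) → toℕ (shift-index i j) ≡ toℕ j + i
toℕ-shift-index i j = toℕ-fromℕ< _

shift-index-strict : ∀ {n} i → shift-index {n} i Preserves _<_ ⟶ _<_
shift-index-strict i {j} {k} j<k =
  subst₂ ℕ._<_ (sym (toℕ-shift-index i j)) (sym (toℕ-shift-index i k)) (ℕ.+-monoˡ-< i j<k)

shift-index-surjective : ∀ {n} i (x : Fin n) → i ℕ.≤ toℕ x → ∃[ j ] shift-index i j ≡ x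
shift-index-surjective i x i≤x = j , toℕ-injective (begin
  toℕ (shift-index i j)  ≡⟨ toℕ-shift-index i j ⟩
  toℕ j + i              ≡⟨ cong (_+ i) (toℕ-fromℕ< _) ⟩
  toℕ x ∸ i + i          ≡⟨ ℕ.m∸n+n≡m i≤x ⟩
  toℕ x                  ∎)
  where
  open ≡-Reasoning
  j = fromℕ< (ℕ.∸-monoˡ-< (toℕ<n x) i≤x)

module _ (V : Set) where

  private
    infix 4 _≼_
    _≼_ : Activation V → Activation V → Set₁
    _≼_ = _⊑_ V

  ⊑-refl : (σ : Activation V) → σ ≼ σ
  ⊑-refl σ = record { g = id ; strict = id ; agree = λ _ → ≐-refl }

  ⊑-trans : {σ₁ σ₂ σ₃ : Activation V} → σ₁ ≼ σ₂ → σ₂ ≼ σ₃ → σ₁ ≼ σ₃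
  ⊑-trans e₁ e₂ = record
    { g      = g e₂ ∘ g e₁
    ; strict = strict e₂ ∘ strict e₁
    ; agree  = λ i → ≐-trans (agree e₁ i) (agree e₂ (g e₁ i))
    }

  ⊑-empty : {σ' σ : Activation V} → σ' ≼ σ → len σ ≡ 0 → len σ' ≡ 0
  ⊑-empty e len≡0 = empty-domain (subst (λ n → Fin _ → Fin n) len≡0 (g e))
    where
    empty-domain : ∀ {m} → (Fin m → Fin 0) → m ≡ 0
    empty-domain {ℕ.zero}  _ = refl
    empty-domain {ℕ.suc _} h = ⊥-elim (¬Fin0 (h zero))

  restrict : (σ : Activation V) {m : ℕ} (h : Fin m → Fin (len σ)) →
             h Preserves _<_ ⟶ _<_ → Activation V
  restrict σ {m} h h-strict = act m (at σ ∘ h) (mono σ ∘ strict⇒monotone h-strict)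

  restrict-⊑ : (σ : Activation V) {m : ℕ} (h : Fin m → Fin (len σ))
               (h-strict : h Preserves _<_ ⟶ _<_) → restrict σ h h-strict ≼ σ
  restrict-⊑ σ h h-strict = record { g = h ; strict = h-strict ; agree = λ _ → ≐-refl }

  shift-⊑ : (σ : Activation V) (i : ℕ) → shift V σ i ≼ σ
  shift-⊑ σ i = record { g = shift-index i ; strict = shift-index-strict i ; agree = λ _ → ≐-refl }

  ⊑-factor : {σ' σ₁ σ : Activation V} (e : σ' ≼ σ) (e₁ : σ₁ ≼ σ) →
             (∀ j → ∃[ k ] g e₁ k ≡ g e j) → σ' ≼ σ₁
  ⊑-factor {σ'} {σ₁} {σ} e e₁ lift-index = record { g = G ; strict = G-strict ; agree = G-agree }
    where
    G : Fin (len σ') → Fin (len σ₁)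
    G j = proj₁ (lift-index j)

    g∘G : ∀ j → g e₁ (G j) ≡ g e j
    g∘G j = proj₂ (lift-index j)

    G-strict : G Preserves _<_ ⟶ _<_
    G-strict {i} {j} i<j =
      strict-reflects (strict e₁) (subst₂ _<_ (sym (g∘G i)) (sym (g∘G j)) (strict e i<j))

    G-agree : ∀ j → at σ' j ≐ at σ₁ (G j)
    G-agree j = ≐-trans (agree e j)
      (subst (λ x → at σ x ≐ at σ₁ (G j)) (g∘G j) (≐-sym (agree e₁ (G j))))

  shift-mono-⊑ : {σ' σ : Activation V} → σ' ≼ σ → (i : ℕ) → shift V σ' i ≼ shift V σ i
  shift-mono-⊑ {σ'} {σ} e i =
    ⊑-factor (⊑-trans (shift-⊑ σ' i) e) (shift-⊑ σ i)
             (λ j → shift-index-surjective i _ (i≤image j))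
    where
    open ℕ.≤-Reasoning hiding (strict)
    i≤image : ∀ j → i ℕ.≤ toℕ (g e (shift-index i j))
    i≤image j = begin
      i                              ≤⟨ ℕ.m≤n+m i (toℕ j) ⟩
      toℕ j + i                      ≡⟨ toℕ-shift-index i j ⟨
      toℕ (shift-index i j)          ≤⟨ strict-inflationary (g e) (strict e) _ ⟩
      toℕ (g e (shift-index i j))    ∎

  Covers-pullback : {σ' σ₁ σ₂ σ : Activation V}
    (e : σ' ≼ σ) (e₁ : σ₁ ≼ σ) (e₂ : σ₂ ≼ σ) → Covers V e₁ e₂ →
    Σ (Activation V) λ σ₁' → Σ (Activation V) λ σ₂' →
    Σ (σ₁' ≼ σ') λ e₁' → Σ (σ₂' ≼ σ') λ e₂' →
    Covers V e₁' e₂' × σ₁' ≼ σ₁ × σ₂' ≼ σ₂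
  Covers-pullback {σ'} e e₁ e₂ cover =
    part b₁ , part b₂ , part-⊑ b₁ , part-⊑ b₂ , covers ,
    ⊑-factor (⊑-trans (part-⊑ b₁) e) e₁
      (λ k → to-witness-T (isInj₁ (cover (g e (select b₁ k)))) (select-sound b₁ k)) ,
    ⊑-factor (⊑-trans (part-⊑ b₂) e) e₂
      (λ k → to-witness-T (isInj₂ (cover (g e (select b₂ k)))) (select-sound b₂ k))
    where
    b₁ b₂ : Fin (len σ') → Bool
    b₁ j = is-just (isInj₁ (cover (g e j)))
    b₂ j = is-just (isInj₂ (cover (g e j)))

    part : (Fin (len σ') → Bool) → Activation V
    part b = restrict σ' (select b) (select-strict b)

    part-⊑ : (b : Fin (len σ') → Bool) → part b ≼ σ'
    part-⊑ b = restrict-⊑ σ' (select b) (select-strict b)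

    which-side : ∀ {A B : Set} (x : A ⊎ B) → T (is-just (isInj₁ x)) ⊎ T (is-just (isInj₂ x))
    which-side (inj₁ _) = inj₁ tt
    which-side (inj₂ _) = inj₂ tt

    covers : Covers V (part-⊑ b₁) (part-⊑ b₂)
    covers j with which-side (cover (g e j))
    ... | inj₁ in₁ = inj₁ (select-complete b₁ j in₁)
    ... | inj₂ in₂ = inj₂ (select-complete b₂ j in₂)

  Sat-empty : (σ : Activation V) → len σ ≡ 0 → (φ : Ty V) (f : B V φ) → Sat V σ φ f
  Sat-empty σ len≡0 (`A a)   _              =
    lift (λ i → ⊥-elim (¬Fin0 (subst Fin len≡0 i)))
  Sat-empty σ len≡0 `true    _              = lift tt
  Sat-empty σ len≡0 `false   _              = lift len≡0
  Sat-empty σ len≡0 (φ ∧ ψ)  (f , h)        = Sat-empty σ len≡0 φ f , Sat-empty σ len≡0 ψ h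
  Sat-empty σ len≡0 (¬' φ)   _              = λ σ' e _ _ → lift (⊑-empty e len≡0)
  Sat-empty σ len≡0 (φ ⊃ ψ)  f              =
    λ σ' e h _ → Sat-empty σ' (⊑-empty e len≡0) ψ (f h)
  Sat-empty σ len≡0 (φ ∨ ψ)  (zero , f)     = Sat-empty σ len≡0 φ f
  Sat-empty σ len≡0 (φ ∨ ψ)  (suc _ , h)    = Sat-empty σ len≡0 ψ h
  Sat-empty σ len≡0 (φ ⊕ ψ)  (f , _)        = inj₁ (Sat-empty σ len≡0 φ f)
  Sat-empty σ len≡0 (φ ⊗ ψ)  (f , h)        =
    σ , σ , ⊑-refl σ , ⊑-refl σ , lift (λ i → inj₁ (i , refl)) ,
    Sat-empty σ len≡0 φ f , Sat-empty σ len≡0 ψ h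
  Sat-empty σ len≡0 (○ φ)    _              = inj₁ (lift len≡0)

  Sat-antitone : (φ : Ty V) (f : B V φ) (σ : Activation V) → Sat V σ φ f →
                 (σ' : Activation V) → σ' ≼ σ → Sat V σ' φ f
  Sat-antitone (`A a)  _           σ (lift all-a) σ' e =
    lift (λ i → proj₂ (agree e i) (all-a (g e i)))
  Sat-antitone `true   _           σ _            σ' e = lift tt
  Sat-antitone `false  _           σ (lift len≡0) σ' e = lift (⊑-empty e len≡0)
  Sat-antitone (φ ∧ ψ) (f , h)     σ (s , t)      σ' e =
    Sat-antitone φ f σ s σ' e , Sat-antitone ψ h σ t σ' e
  Sat-antitone (¬' φ)  _           σ s            σ' e = λ σ'' e' → s σ'' (⊑-trans e' e)
  Sat-antitone (φ ⊃ ψ) _           σ s            σ' e = λ σ'' e' → s σ'' (⊑-trans e' e)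
  Sat-antitone (φ ∨ ψ) (zero , f)  σ s            σ' e = Sat-antitone φ f σ s σ' e
  Sat-antitone (φ ∨ ψ) (suc _ , h) σ s            σ' e = Sat-antitone ψ h σ s σ' e
  Sat-antitone (φ ⊕ ψ) (f , _)     σ (inj₁ s)     σ' e = inj₁ (Sat-antitone φ f σ s σ' e)
  Sat-antitone (φ ⊕ ψ) (_ , h)     σ (inj₂ t)     σ' e = inj₂ (Sat-antitone ψ h σ t σ' e)
  Sat-antitone (○ φ)   _           σ (inj₁ (lift len≡0)) σ' e = inj₁ (lift (⊑-empty e len≡0))
  Sat-antitone (○ φ)   (_ , f)     σ (inj₂ (i , i≤d , s)) σ' e =
    inj₂ (i , i≤d , Sat-antitone φ f (shift V σ i) s (shift V σ' i) (shift-mono-⊑ e i))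
  Sat-antitone (φ ⊗ ψ) (f , h)     σ (σ₁ , σ₂ , e₁ , e₂ , lift cover , s₁ , s₂) σ' e
    with Covers-pullback e e₁ e₂ cover
  ... | σ₁' , σ₂' , e₁' , e₂' , cover' , σ₁'≼σ₁ , σ₂'≼σ₂ =
    σ₁' , σ₂' , e₁' , e₂' , lift cover' ,
    Sat-antitone φ f σ₁ s₁ σ₁' σ₁'≼σ₁ , Sat-antitone ψ h σ₂ s₂ σ₂' σ₂'≼σ₂

proposition1 : (V : Set) →
    ((φ : Ty V) (f : B V φ) (σ : Activation V) → Sat V σ φ f →
       ∀ (σ' : Activation V) → _⊑_ V σ' σ → Sat V σ' φ f)
    × ((σ : Activation V) → len σ ≡ 0 → ∀ (φ : Ty V) (f : B V φ) → Sat V σ φ f)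
proposition1 V = Sat-antitone V , Sat-empty V
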